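{- Let $n$ be a positive integer and let $\mathrm{TH}_m=\binom{m+2}{3}$ denote the $m$th tetrahedral number. Then ${\mathrm F}(\mathrm{TH}_n,\mathrm{TH}_{n+1},\mathrm{TH}_{n+2},\mathrm{TH}_{n+3})$ equals: (1) $\frac{n-3}{3}\mathrm{TH}_{n+1}+n\,\mathrm{TH}_{n+2}+\frac{n}{2}\mathrm{TH}_{n+3}-\mathrm{TH}_n$, if $n=6k$; (2) $(n-1)\mathrm{TH}_{n+1}+\frac{n-1}{2}\mathrm{TH}_{n+2}+\frac{n-1}{3}\mathrm{TH}_{n+3}-\mathrm{TH}_n$, if $n=6k+1$; (3) $(n-1)\mathrm{TH}_{n+1}+\frac{n-2}{3}\mathrm{TH}_{n+2}+\frac{n}{2}\mathrm{TH}_{n+3}-\mathrm{TH}_n$, if $n=6k+2$; (4) $\frac{n-3}{3}\mathrm{TH}_{n+1}+\frac{n-1}{2}\mathrm{TH}_{n+2}+(n+1)\mathrm{TH}_{n+3}-\mathrm{TH}_n$, if $n=6k+3$; (5) $\frac{n+2}{3}\mathrm{TH}_{n+2}+\frac{n+2}{2}\mathrm{TH}_{n+1}+(n+2)\mathrm{TH}_n-\mathrm{TH}_{n+3}$, if $n=6k+4$; (6) $(n+4)\mathrm{TH}_{n+2}+\frac{n+1}{3}\mathrm{TH}_{n+1}+\frac{n+1}{2}\mathrm{TH}_n-\mathrm{TH}_{n+3}$, if $n=6k+5$; where $k$ denotes a non-negative integer.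
   Context: For relatively prime positive integers $a_1,\ldots,a_k$, the Frobenius number ${\mathrm F}(a_1,\ldots,a_k)$ is the largest integer that is not representable as a non-negative integer linear combination of $a_1,\ldots,a_k$ (with the convention that it equals $-1$ when every non-negative integer is representable). Four consecutive tetrahedral numbers are relatively prime. -}

module Defs where

open import Data.Nat using (ℕ; _+_; _*_)
open import Data.Nat.Combinatorics using (_C_)
open import Data.Integer using (ℤ; +_) renaming (_+_ to _+ℤ_; _*_ to _*ℤ_; _<_ to _<ℤ_)
open import Data.Product using (∃; _×_)
open import Data.Product using (Σ-syntax; ∃-syntax)
open import Relation.Binary.PropositionalEquality using (_≡_)
open import Relation.Nullary using (¬_)

TH : ℕ → ℕ
TH m = (m + 2) C 3

Representable : ℕ → ℕ → ℕ → ℕ → ℤ → Set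
Representable a b c d z =
  ∃[ x ] ∃[ y ] ∃[ u ] ∃[ v ] (z ≡ + (x * a + y * b + u * c + v * d))

-- f is the Frobenius number of a, b, c, d: the largest integer that is not
-- representable (negative integers are never representable, so this is -1
-- when every non-negative integer is representable).
IsFrobenius : ℕ → ℕ → ℕ → ℕ → ℤ → Set
IsFrobenius a b c d f =
  ¬ Representable a b c d f × (∀ z → f <ℤ z → Representable a b c d z)

{-# OPTIONS --safe #-}
-- Johnson's reduction: if a numerical semigroup P has conductor s (its Frobenius number plus
-- one), c ∈ P and gcd (c, d) = 1, then d P + ℕ c has conductor d s + (d - 1) (c - 1), because
-- its elements have unique normal forms j c + d p with j < d.  Among four consecutive
-- tetrahedral numbers, three share a large common factor d₁ (n + 2 or n + 3, or a half or a
-- third of it, according to n mod 6), and the fourth lies in the semigroup generated by their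
-- quotients.  Those three quotients reduce in the same way, by a common factor d₂, to a coprime
-- pair, where Sylvester's formula applies.  So each residue class of n mod 6 is two reductions
-- on top of Sylvester, and what remains are polynomial identities in k.
module Submission where

open import Defs
open import Data.Nat using (ℕ; _+_; _*_; _≥_)
open import Data.Integer using (ℤ; +_; -_) renaming (_+_ to _+ℤ_; _*_ to _*ℤ_; _-_ to _-ℤ_)
open import Data.Product using (_×_)
open import Relation.Binary.PropositionalEquality using (_≡_)

open import Data.Nat using (zero; suc; _∸_; _≤_; _<_; _≤?_; NonZero; _%_; _/_)
open import Data.Nat.Properties
open import Data.Nat.DivMod using (m≡m%n+[m/n]*n; m%n<n; m<n⇒m%n≡m; [m+kn]%n≡m%n; %-distribˡ-*; %-remove-+ʳ)
open import Data.Nat.Divisibility using (m∣m*n)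
open import Data.Nat.Combinatorics using (_C_; nCk+nC[k+1]≡[n+1]C[k+1]; nC1≡n)
open import Data.Nat.Tactic.RingSolver using (solve)
open import Data.Integer using (-[1+_]; _⊖_; +<+; -<-) renaming (_<_ to _<ℤ_)
import Data.Integer.Properties as ℤ
open import Data.List using (List; []; _∷_; _∷ʳ_; map)
open import Data.List.Relation.Binary.Permutation.Propositional as ↭ using (_↭_; ↭-sym)
open import Data.List.Relation.Binary.Permutation.Propositional.Properties using (∷↭∷ʳ)
open import Data.Product using (∃-syntax; _,_; proj₂)
open import Data.Empty using (⊥-elim)
open import Relation.Binary.PropositionalEquality using (refl; sym; trans; cong; cong₂; subst; module ≡-Reasoning)
open import Relation.Nullary using (¬_; yes; no)

infix 4 _∈⟨_⟩
infixr 5 _▸_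

data _∈⟨_⟩ : ℕ → List ℕ → Set where
  ε   : 0 ∈⟨ [] ⟩
  _▸_ : ∀ {g gs r} x → r ∈⟨ gs ⟩ → x * g + r ∈⟨ g ∷ gs ⟩

∈⟨⟩-≡ : ∀ {gs m n} → n ∈⟨ gs ⟩ → n ≡ m → m ∈⟨ gs ⟩
∈⟨⟩-≡ n∈ refl = n∈

+-∈⟨⟩ : ∀ {gs a b} → a ∈⟨ gs ⟩ → b ∈⟨ gs ⟩ → a + b ∈⟨ gs ⟩
+-∈⟨⟩ ε ε = ε
+-∈⟨⟩ (_▸_ {g} {r = r} x r∈) (_▸_ {r = r′} x′ r′∈) =
  ∈⟨⟩-≡ ((x + x′) ▸ +-∈⟨⟩ r∈ r′∈) (solve (x ∷ g ∷ r ∷ x′ ∷ r′ ∷ []))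

∈⟨⟩-↭ : ∀ {xs ys m} → xs ↭ ys → m ∈⟨ xs ⟩ → m ∈⟨ ys ⟩
∈⟨⟩-↭ ↭.refl         m∈       = m∈
∈⟨⟩-↭ (↭.prep g p)   (x ▸ r∈) = x ▸ ∈⟨⟩-↭ p r∈
∈⟨⟩-↭ (↭.swap g h p) (x ▸ _▸_ {r = r} y r∈) =
  ∈⟨⟩-≡ (y ▸ x ▸ ∈⟨⟩-↭ p r∈) (solve (x ∷ g ∷ y ∷ h ∷ r ∷ []))
∈⟨⟩-↭ (↭.trans p q)  m∈       = ∈⟨⟩-↭ q (∈⟨⟩-↭ p m∈)

*-∈⟨map-*⟩ : ∀ d {gs p} → p ∈⟨ gs ⟩ → d * p ∈⟨ map (d *_) gs ⟩
*-∈⟨map-*⟩ d ε                      = ∈⟨⟩-≡ ε (sym (*-zeroʳ d))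
*-∈⟨map-*⟩ d (_▸_ {g} {r = r} x r∈) = ∈⟨⟩-≡ (x ▸ *-∈⟨map-*⟩ d r∈) (solve (x ∷ d ∷ g ∷ r ∷ []))

∈⟨map-*⟩⇒* : ∀ d gs {m} → m ∈⟨ map (d *_) gs ⟩ → ∃[ p ] p ∈⟨ gs ⟩ × m ≡ d * p
∈⟨map-*⟩⇒* d []       ε        = 0 , ε , sym (*-zeroʳ d)
∈⟨map-*⟩⇒* d (g ∷ gs) (x ▸ r∈) with ∈⟨map-*⟩⇒* d gs r∈
... | p , p∈ , refl = x * g + p , x ▸ p∈ , solve (x ∷ d ∷ g ∷ p ∷ [])

-- The conductor, unlike the Frobenius number, stays in ℕ; gap is vacuous when s = 0.
record IsConductor (P : ℕ → Set) (s : ℕ) : Set where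
  constructor isConductor
  field
    gap    : ∀ {m} → suc m ≡ s → ¬ P m
    beyond : ∀ {m} → s ≤ m → P m

IsConductor-resp : ∀ {P Q : ℕ → Set} {s} → (∀ {m} → P m → Q m) → (∀ {m} → Q m → P m) →
                   IsConductor P s → IsConductor Q s
IsConductor-resp P⇒Q Q⇒P (isConductor gap beyond) =
  isConductor (λ eq q → gap eq (Q⇒P q)) (λ le → P⇒Q (beyond le))

Dilation : ℕ → ℕ → (ℕ → Set) → ℕ → Set
Dilation d c P m = ∃[ j ] ∃[ p ] P p × m ≡ j * c + d * p

module Residues {d c x y : ℕ} .{{_ : NonZero d}} (c-invertible : x * c ≡ 1 + y * d) where

  residue-injective : ∀ {j j′} → j < d → j′ < d → j * c % d ≡ j′ * c % d → j ≡ j′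
  residue-injective {j} {j′} j<d j′<d eq = begin
    j                         ≡⟨ inverse j<d ⟨
    j * c % d * (x % d) % d   ≡⟨ cong (λ r → r * (x % d) % d) eq ⟩
    j′ * c % d * (x % d) % d  ≡⟨ inverse j′<d ⟩
    j′                        ∎
    where
    open ≡-Reasoning
    inverse : ∀ {i} → i < d → i * c % d * (x % d) % d ≡ i
    inverse {i} i<d = begin
      i * c % d * (x % d) % d  ≡⟨ %-distribˡ-* (i * c) x d ⟨
      i * c * x % d            ≡⟨ cong (_% d) expand ⟩
      (i + i * y * d) % d      ≡⟨ [m+kn]%n≡m%n i (i * y) d ⟩
      i % d                    ≡⟨ m<n⇒m%n≡m i<d ⟩
      i                        ∎
      where
      expand : i * c * x ≡ i + i * y * d
      expand = begin
        i * c * x        ≡⟨ solve (i ∷ c ∷ x ∷ []) ⟩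
        i * (x * c)      ≡⟨ cong (i *_) c-invertible ⟩
        i * (1 + y * d)  ≡⟨ solve (i ∷ y ∷ d ∷ []) ⟩
        i + i * y * d    ∎

  normal-form-unique : ∀ {j j′ p p′} → j < d → j′ < d → j * c + d * p ≡ j′ * c + d * p′ →
                       j ≡ j′ × p ≡ p′
  normal-form-unique {j} {j′} {p} {p′} j<d j′<d eq = j≡j′ , p≡p′
    where
    open ≡-Reasoning
    j≡j′ : j ≡ j′
    j≡j′ = residue-injective j<d j′<d (begin
      j * c % d              ≡⟨ %-remove-+ʳ (j * c) (m∣m*n p) ⟨
      (j * c + d * p) % d    ≡⟨ cong (_% d) eq ⟩
      (j′ * c + d * p′) % d  ≡⟨ %-remove-+ʳ (j′ * c) (m∣m*n p′) ⟩
      j′ * c % d             ∎)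
    p≡p′ : p ≡ p′
    p≡p′ = *-cancelˡ-≡ p p′ d
             (+-cancelˡ-≡ (j′ * c) _ _ (subst (λ i → i * c + d * p ≡ j′ * c + d * p′) j≡j′ eq))

  representative : ∀ m → ∃[ j ] ∃[ A ] ∃[ B ] j < d × m + d * A ≡ j * c + d * B
  representative m = r , m * y , q * c , m%n<n (m * x) d , (begin
    m + d * (m * y)        ≡⟨ solve (m ∷ y ∷ d ∷ []) ⟩
    m * (1 + y * d)        ≡⟨ cong (m *_) c-invertible ⟨
    m * (x * c)            ≡⟨ *-assoc m x c ⟨
    m * x * c              ≡⟨ cong (_* c) (m≡m%n+[m/n]*n (m * x) d) ⟩
    (r + q * d) * c        ≡⟨ distrib r q ⟩
    r * c + d * (q * c)    ∎)
    where
    open ≡-Reasoning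
    r = m * x % d
    q = m * x / d
    distrib : ∀ r q → (r + q * d) * c ≡ r * c + d * (q * c)
    distrib r q = solve (r ∷ q ∷ d ∷ c ∷ [])

+-*-closed : ∀ {c} {P : ℕ → Set} → (∀ {p} → P p → P (p + c)) → ∀ t {p} → P p → P (p + t * c)
+-*-closed     {P = P} closed zero    {p} p∈ = subst P (sym (+-identityʳ p)) p∈
+-*-closed {c} {P}     closed (suc t) {p} p∈ =
  subst P (+-assoc p c (t * c)) (+-*-closed {c} {P} closed t (closed p∈))

normalise : ∀ {d c m} .{{_ : NonZero d}} {P : ℕ → Set} → (∀ {p} → P p → P (p + c)) →
            Dilation d c P m → ∃[ j ] ∃[ p ] j < d × P p × m ≡ j * c + d * p
normalise {d} {c} {P = P} closed (j , p , p∈ , refl) =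
  j % d , p + j / d * c , m%n<n j d , +-*-closed {c} {P} closed (j / d) p∈ ,
  trans (cong (λ i → i * c + d * p) (m≡m%n+[m/n]*n j d)) (distrib (j % d) (j / d))
  where
  distrib : ∀ r q → (r + q * d) * c + d * p ≡ r * c + d * (p + q * c)
  distrib r q = solve (r ∷ q ∷ d ∷ c ∷ p ∷ [])

-- With d = suc e, the last hypothesis says s′ = d s + (d - 1) (c - 1).
dilation-conductor : ∀ {e c x y s s′} {P : ℕ → Set} → x * c ≡ 1 + y * suc e →
                     (∀ {p} → P p → P (p + c)) → IsConductor P s → s′ + e ≡ suc e * s + e * c →
                     IsConductor (Dilation (suc e) c P) s′
dilation-conductor {e} {c} {x} {y} {s} {s′} {P} c-invertible closed (isConductor gap beyond) s′-eq =
  isConductor gap′ beyond′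
  where
  open Residues {suc e} {c} {x} {y} c-invertible

  bound : ∀ {m} → s′ ≤ m → e * c + suc e * s < m + suc e
  bound {m} s′≤m = begin-strict
    e * c + suc e * s  ≡⟨ +-comm (e * c) _ ⟩
    suc e * s + e * c  ≡⟨ s′-eq ⟨
    s′ + e             ≤⟨ +-monoˡ-≤ e s′≤m ⟩
    m + e              <⟨ +-monoʳ-< m ≤-refl ⟩
    m + suc e          ∎
    where open ≤-Reasoning

  gap′ : ∀ {m} → suc m ≡ s′ → ¬ Dilation (suc e) c P m
  gap′ {m} 1+m≡s′ m∈ with normalise {suc e} closed m∈
  ... | j , p , j<d , p∈ , refl = gap (sym (proj₂ (normal-form-unique ≤-refl j<d eq))) p∈
    where
    open ≡-Reasoning
    eq : e * c + suc e * s ≡ j * c + suc e * suc p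
    eq = begin
      e * c + suc e * s              ≡⟨ +-comm (e * c) _ ⟩
      suc e * s + e * c              ≡⟨ s′-eq ⟨
      s′ + e                         ≡⟨ cong (_+ e) 1+m≡s′ ⟨
      suc (j * c + suc e * p) + e    ≡⟨ solve (j ∷ c ∷ e ∷ p ∷ []) ⟩
      j * c + suc e * suc p          ∎

  in-normal-form : ∀ {m j w} → s′ ≤ m → j < suc e → m ≡ j * c + suc e * w → Dilation (suc e) c P m
  in-normal-form {m} {j} {w} s′≤m j<d refl with s ≤? w
  ... | yes s≤w = j , w , beyond s≤w , refl
  ... | no s≰w  = ⊥-elim (<⇒≱ (bound s′≤m) (begin
    m + suc e                ≡⟨ solve (j ∷ c ∷ e ∷ w ∷ []) ⟩
    j * c + suc e * suc w    ≤⟨ +-mono-≤ (*-monoˡ-≤ c (≤-pred j<d)) (*-monoʳ-≤ (suc e) (≰⇒> s≰w)) ⟩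
    e * c + suc e * s        ∎))
    where open ≤-Reasoning

  beyond′ : ∀ {m} → s′ ≤ m → Dilation (suc e) c P m
  beyond′ {m} s′≤m with representative m
  ... | j , A , B , j<d , eq with A ≤? B
  ... | yes A≤B with m≤n⇒∃[o]m+o≡n A≤B
  ...   | w , refl = in-normal-form s′≤m j<d (+-cancelʳ-≡ (suc e * A) _ _ (trans eq (shuffle j A w)))
    where
    shuffle : ∀ j A w → j * c + suc e * (A + w) ≡ j * c + suc e * w + suc e * A
    shuffle j A w = solve (j ∷ c ∷ e ∷ A ∷ w ∷ [])
  beyond′ {m} s′≤m | j , A , B , j<d , eq | no A≰B with m≤n⇒∃[o]m+o≡n (≰⇒> A≰B)
  ...   | z , refl = ⊥-elim (<⇒≱ (bound s′≤m) (begin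
    m + suc e                      ≤⟨ m≤m+n (m + suc e) (suc e * z) ⟩
    m + suc e + suc e * z          ≡⟨ +-cancelʳ-≡ (suc e * B) _ _ (trans (shuffle m B z) eq) ⟩
    j * c                          ≤⟨ *-monoˡ-≤ c (≤-pred j<d) ⟩
    e * c                          ≤⟨ m≤m+n (e * c) (suc e * s) ⟩
    e * c + suc e * s              ∎))
    where
    open ≤-Reasoning
    shuffle : ∀ m B z → m + suc e + suc e * z + suc e * B ≡ m + suc e * (suc B + z)
    shuffle m B z = solve (m ∷ e ∷ z ∷ B ∷ [])

conductor-∷ : ∀ e c x y {bs s s′} → IsConductor (_∈⟨ bs ⟩) s →
              x * c ≡ 1 + y * suc e → c ∈⟨ bs ⟩ → s′ + e ≡ suc e * s + e * c →
              IsConductor (_∈⟨ c ∷ map (suc e *_) bs ⟩) s′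
conductor-∷ e c x y {bs} conductor c-invertible c∈ s′-eq =
  IsConductor-resp to from
    (dilation-conductor {x = x} {y} c-invertible (λ p∈ → +-∈⟨⟩ p∈ c∈) conductor s′-eq)
  where
  to : ∀ {m} → Dilation (suc e) c (_∈⟨ bs ⟩) m → m ∈⟨ c ∷ map (suc e *_) bs ⟩
  to (j , p , p∈ , refl) = j ▸ *-∈⟨map-*⟩ (suc e) p∈
  from : ∀ {m} → m ∈⟨ c ∷ map (suc e *_) bs ⟩ → Dilation (suc e) c (_∈⟨ bs ⟩) m
  from (j ▸ r∈) with ∈⟨map-*⟩⇒* (suc e) bs r∈
  ... | p , p∈ , refl = j , p , p∈ , refl

conductor-∷ʳ : ∀ e c x y {bs s s′} → IsConductor (_∈⟨ bs ⟩) s →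
               x * c ≡ 1 + y * suc e → c ∈⟨ bs ⟩ → s′ + e ≡ suc e * s + e * c →
               IsConductor (_∈⟨ map (suc e *_) bs ∷ʳ c ⟩) s′
conductor-∷ʳ e c x y {bs} conductor c-invertible c∈ s′-eq =
  IsConductor-resp (∈⟨⟩-↭ (∷↭∷ʳ c gs)) (∈⟨⟩-↭ (↭-sym (∷↭∷ʳ c gs)))
    (conductor-∷ e c x y conductor c-invertible c∈ s′-eq)
  where gs = map (suc e *_) bs

conductor-suc-∷ : ∀ e c x y {bs f} → IsConductor (_∈⟨ bs ⟩) (suc f) →
                  x * c ≡ 1 + y * suc e → c ∈⟨ bs ⟩ →
                  IsConductor (_∈⟨ c ∷ map (suc e *_) bs ⟩) (suc (suc e * f + e * c))
conductor-suc-∷ e c x y {f = f} conductor c-invertible c∈ =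
  conductor-∷ e c x y conductor c-invertible c∈ (solve (e ∷ c ∷ f ∷ []))

conductor-suc-∷ʳ : ∀ e c x y {bs f} → IsConductor (_∈⟨ bs ⟩) (suc f) →
                   x * c ≡ 1 + y * suc e → c ∈⟨ bs ⟩ →
                   IsConductor (_∈⟨ map (suc e *_) bs ∷ʳ c ⟩) (suc (suc e * f + e * c))
conductor-suc-∷ʳ e c x y {f = f} conductor c-invertible c∈ =
  conductor-∷ʳ e c x y conductor c-invertible c∈ (solve (e ∷ c ∷ f ∷ []))

∈⟨1⟩ : ∀ m → m ∈⟨ 1 ∷ [] ⟩
∈⟨1⟩ m = ∈⟨⟩-≡ (m ▸ ε) (solve (m ∷ []))

sylvester : ∀ a b x y → x * suc b ≡ 1 + y * suc a → IsConductor (_∈⟨ suc a ∷ suc b ∷ [] ⟩) (a * b)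
sylvester a b x y b-invertible =
  subst (λ g → IsConductor (_∈⟨ g ∷ suc b ∷ [] ⟩) (a * b)) (*-identityʳ (suc a))
    (conductor-∷ʳ a (suc b) x y {s′ = a * b} conductor-⟨1⟩ b-invertible (∈⟨1⟩ (suc b))
       (solve (a ∷ b ∷ [])))
  where
  conductor-⟨1⟩ : IsConductor (_∈⟨ 1 ∷ [] ⟩) 0
  conductor-⟨1⟩ = isConductor (λ ()) λ {m} _ → ∈⟨1⟩ m

2*[m+2]C2≡[m+1]*[m+2] : ∀ m → 2 * ((m + 2) C 2) ≡ (m + 1) * (m + 2)
2*[m+2]C2≡[m+1]*[m+2] zero    = refl
2*[m+2]C2≡[m+1]*[m+2] (suc m) = begin
  2 * ((suc m + 2) C 2)             ≡⟨ cong (2 *_) (nCk+nC[k+1]≡[n+1]C[k+1] (m + 2) 1) ⟨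
  2 * ((m + 2) C 1 + (m + 2) C 2)   ≡⟨ cong (λ t → 2 * (t + (m + 2) C 2)) (nC1≡n (m + 2)) ⟩
  2 * (m + 2 + (m + 2) C 2)         ≡⟨ *-distribˡ-+ 2 (m + 2) _ ⟩
  2 * (m + 2) + 2 * ((m + 2) C 2)   ≡⟨ cong (λ t → 2 * (m + 2) + t) (2*[m+2]C2≡[m+1]*[m+2] m) ⟩
  2 * (m + 2) + (m + 1) * (m + 2)   ≡⟨ solve (m ∷ []) ⟩
  (suc m + 1) * (suc m + 2)         ∎
  where open ≡-Reasoning

6*TH≡m*[m+1]*[m+2] : ∀ m → 6 * TH m ≡ m * (m + 1) * (m + 2)
6*TH≡m*[m+1]*[m+2] zero    = refl
6*TH≡m*[m+1]*[m+2] (suc m) = begin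
  6 * ((suc m + 2) C 3)                            ≡⟨ cong (6 *_) (nCk+nC[k+1]≡[n+1]C[k+1] (m + 2) 2) ⟨
  6 * ((m + 2) C 2 + TH m)                         ≡⟨ regroup ((m + 2) C 2) (TH m) ⟩
  3 * (2 * ((m + 2) C 2)) + 6 * TH m               ≡⟨ cong₂ (λ a b → 3 * a + b) (2*[m+2]C2≡[m+1]*[m+2] m)
                                                                                (6*TH≡m*[m+1]*[m+2] m) ⟩
  3 * ((m + 1) * (m + 2)) + m * (m + 1) * (m + 2)  ≡⟨ solve (m ∷ []) ⟩
  suc m * (suc m + 1) * (suc m + 2)                ∎
  where
  open ≡-Reasoning
  regroup : ∀ a b → 6 * (a + b) ≡ 3 * (2 * a) + 6 * b
  regroup a b = solve (a ∷ b ∷ [])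

THs : ℕ → List ℕ
THs n = TH n ∷ TH (n + 1) ∷ TH (n + 2) ∷ TH (n + 3) ∷ []

TH-≡ : ∀ {m t} → 6 * t ≡ m * (m + 1) * (m + 2) → t ≡ TH m
TH-≡ {m} eq = *-cancelˡ-≡ _ _ 6 (trans eq (sym (6*TH≡m*[m+1]*[m+2] m)))

≡THs : ∀ n {g₀ g₁ g₂ g₃} →
       6 * g₀ ≡ n * (n + 1) * (n + 2) → 6 * g₁ ≡ (n + 1) * (n + 1 + 1) * (n + 1 + 2) →
       6 * g₂ ≡ (n + 2) * (n + 2 + 1) * (n + 2 + 2) → 6 * g₃ ≡ (n + 3) * (n + 3 + 1) * (n + 3 + 2) →
       g₀ ∷ g₁ ∷ g₂ ∷ g₃ ∷ [] ≡ THs n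
≡THs n eq₀ eq₁ eq₂ eq₃ =
  cong₂ _∷_ (TH-≡ {n} eq₀)
    (cong₂ _∷_ (TH-≡ {n + 1} eq₁) (cong₂ _∷_ (TH-≡ {n + 2} eq₂) (cong (_∷ []) (TH-≡ {n + 3} eq₃))))

isFrobenius : ∀ {a b c d t f} → IsConductor (_∈⟨ a ∷ b ∷ c ∷ d ∷ [] ⟩) (suc t) → f ≡ + t →
              IsFrobenius a b c d f
isFrobenius {a} {b} {c} {d} {t} (isConductor gap beyond) refl = (λ t∈ → gap refl (from t∈)) , to
  where
  from : ∀ {m} → Representable a b c d (+ m) → m ∈⟨ a ∷ b ∷ c ∷ d ∷ [] ⟩
  from (x , y , u , v , eq) =
    ∈⟨⟩-≡ (x ▸ y ▸ u ▸ v ▸ ε)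
      (sym (trans (ℤ.+-injective eq) (solve (x ∷ a ∷ y ∷ b ∷ u ∷ c ∷ v ∷ d ∷ []))))
  to : ∀ z → + t <ℤ z → Representable a b c d z
  to (+ m) (+<+ t<m) with beyond t<m
  ... | x ▸ y ▸ u ▸ v ▸ ε = x , y , u , v , cong +_ (solve (x ∷ a ∷ y ∷ b ∷ u ∷ c ∷ v ∷ d ∷ []))

isFrobenius-1 : ∀ {b c d} → IsFrobenius 1 b c d -[1+ 0 ]
isFrobenius-1 = (λ { (_ , _ , _ , _ , ()) }) , λ where
  (+ m)     _          → m , 0 , 0 , 0 , cong +_ (solve (m ∷ []))
  -[1+ _ ] (-<- ())

combination-value : ∀ {a} α u β v γ w z t → a ≡ + α → α * u + β * v + γ * w ≡ t + z →
                    a *ℤ + u +ℤ + β *ℤ + v +ℤ + γ *ℤ + w -ℤ + z ≡ + t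
combination-value α u β v γ w z t refl eq = begin
  + α *ℤ + u +ℤ + β *ℤ + v +ℤ + γ *ℤ + w -ℤ + z  ≡⟨ cong (_-ℤ + z) pos-combination ⟨
  + (α * u + β * v + γ * w) -ℤ + z                ≡⟨ cong (λ n → + n -ℤ + z) eq ⟩
  + (t + z) -ℤ + z                                ≡⟨ ℤ.m-n≡m⊖n (t + z) z ⟩
  (t + z) ⊖ z                                     ≡⟨ ℤ.⊖-≥ (m≤n+m z t) ⟩
  + (t + z ∸ z)                                   ≡⟨ cong +_ (m+n∸n≡m t z) ⟩
  + t                                             ∎
  where
  open ≡-Reasoning
  pos-combination : + (α * u + β * v + γ * w) ≡ + α *ℤ + u +ℤ + β *ℤ + v +ℤ + γ *ℤ + w
  pos-combination = trans (ℤ.pos-+ (α * u + β * v) (γ * w))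
                      (cong₂ _+ℤ_
                        (trans (ℤ.pos-+ (α * u) (β * v)) (cong₂ _+ℤ_ (ℤ.pos-* α u) (ℤ.pos-* β v)))
                        (ℤ.pos-* γ w))

isFrobenius-THs-lower : ∀ n a β γ {α t g₀ g₁ g₂ g₃} → a ≡ + α →
                        IsConductor (_∈⟨ g₀ ∷ g₁ ∷ g₂ ∷ g₃ ∷ [] ⟩) (suc t) →
                        g₀ ∷ g₁ ∷ g₂ ∷ g₃ ∷ [] ≡ THs n →
                        α * g₁ + β * g₂ + γ * g₃ ≡ t + g₀ →
                        IsFrobenius (TH n) (TH (n + 1)) (TH (n + 2)) (TH (n + 3))
                          (a *ℤ + TH (n + 1) +ℤ + β *ℤ + TH (n + 2) +ℤ + γ *ℤ + TH (n + 3) -ℤ + TH n)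
isFrobenius-THs-lower n a β γ {α} {t} a≡ conductor refl eq =
  isFrobenius conductor (combination-value α (TH (n + 1)) β (TH (n + 2)) γ (TH (n + 3)) (TH n) t a≡ eq)

isFrobenius-THs-upper : ∀ n α β γ {t g₀ g₁ g₂ g₃} →
                        IsConductor (_∈⟨ g₀ ∷ g₁ ∷ g₂ ∷ g₃ ∷ [] ⟩) (suc t) →
                        g₀ ∷ g₁ ∷ g₂ ∷ g₃ ∷ [] ≡ THs n →
                        α * g₂ + β * g₁ + γ * g₀ ≡ t + g₃ →
                        IsFrobenius (TH n) (TH (n + 1)) (TH (n + 2)) (TH (n + 3))
                          (+ α *ℤ + TH (n + 2) +ℤ + β *ℤ + TH (n + 1) +ℤ + γ *ℤ + TH n -ℤ + TH (n + 3))
isFrobenius-THs-upper n α β γ {t} conductor refl eq =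
  isFrobenius conductor (combination-value α (TH (n + 2)) β (TH (n + 1)) γ (TH n) (TH (n + 3)) t refl eq)

-- conductor-THa/d is about the semigroup generated by TH a, TH (a + 1) and TH (a + 2), each divided by d.
conductor-TH6k+7/2k+3 : ∀ k →
  IsConductor (_∈⟨ map ((4 + 3 * k) *_) (7 + 6 * k ∷ 10 + 6 * k ∷ []) ∷ʳ (5 + 3 * k) * (11 + 6 * k) ⟩)
              (378 + 873 * k + 657 * (k * k) + 162 * (k * k * k))
conductor-TH6k+7/2k+3 k =
  conductor-∷ʳ (3 + 3 * k) ((5 + 3 * k) * (11 + 6 * k)) (3 + 2 * k) (41 + 44 * k + 12 * (k * k))
    (sylvester (6 + 6 * k) (9 + 6 * k) (5 + 4 * k) (7 + 4 * k) (solve (k ∷ [])))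
    (solve (k ∷ []))
    (∈⟨⟩-≡ ((5 + 3 * k) ▸ 2 ▸ ε) (solve (k ∷ [])))
    (solve (k ∷ []))

conductor-TH6k+3/6k+5 : ∀ k →
  IsConductor (_∈⟨ map ((2 + 3 * k) *_) (1 + 2 * k ∷ 2 + 2 * k ∷ []) ∷ʳ (1 + k) * (7 + 6 * k) ⟩)
              (6 + 35 * k + 59 * (k * k) + 30 * (k * k * k))
conductor-TH6k+3/6k+5 k =
  conductor-∷ʳ (1 + 3 * k) ((1 + k) * (7 + 6 * k)) 1 (3 + 2 * k)
    (sylvester (2 * k) (1 + 2 * k) 1 1 (solve (k ∷ [])))
    (solve (k ∷ []))
    (∈⟨⟩-≡ ((1 + k) ▸ (3 + 2 * k) ▸ ε) (solve (k ∷ [])))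
    (solve (k ∷ []))

conductor-TH6k+5/6k+7 : ∀ k →
  IsConductor (_∈⟨ (1 + k) * (5 + 6 * k) ∷ map ((4 + 3 * k) *_) (2 + 2 * k ∷ 3 + 2 * k ∷ []) ⟩)
              (20 + 75 * k + 85 * (k * k) + 30 * (k * k * k))
conductor-TH6k+5/6k+7 k =
  conductor-∷ (3 + 3 * k) ((1 + k) * (5 + 6 * k)) 1 (1 + 2 * k)
    (sylvester (1 + 2 * k) (2 + 2 * k) 1 1 (solve (k ∷ [])))
    (solve (k ∷ []))
    (∈⟨⟩-≡ ((1 + 2 * k) ▸ (1 + k) ▸ ε) (solve (k ∷ [])))
    (solve (k ∷ []))

conductor-TH6k+6/3k+4 : ∀ k →
  IsConductor (_∈⟨ (2 + 2 * k) * (7 + 6 * k) ∷ map ((3 + 2 * k) *_) (7 + 6 * k ∷ 10 + 6 * k ∷ []) ⟩)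
              (188 + 456 * k + 364 * (k * k) + 96 * (k * k * k))
conductor-TH6k+6/3k+4 k =
  conductor-∷ (2 + 2 * k) ((2 + 2 * k) * (7 + 6 * k)) (2 + k) (9 + 16 * k + 6 * (k * k))
    (sylvester (6 + 6 * k) (9 + 6 * k) (5 + 4 * k) (7 + 4 * k) (solve (k ∷ [])))
    (solve (k ∷ []))
    (∈⟨⟩-≡ ((2 + 2 * k) ▸ 0 ▸ ε) (solve (k ∷ [])))
    (solve (k ∷ []))

frobenius-6k : ∀ n k → n ≥ 1 → n ≡ 6 * k →
               IsFrobenius (TH n) (TH (n + 1)) (TH (n + 2)) (TH (n + 3))
                 ((+ (2 * k) -ℤ + 1) *ℤ + TH (n + 1) +ℤ + (6 * k) *ℤ + TH (n + 2)
                   +ℤ + (3 * k) *ℤ + TH (n + 3) -ℤ + TH n)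
frobenius-6k _ zero    () refl
frobenius-6k _ (suc k) _  refl =
  isFrobenius-THs-lower (6 * suc k) (+ (2 * suc k) -ℤ + 1) (6 * suc k) (3 * suc k)
    -- + (2 * suc k) -ℤ + 1 evaluates to + (k + suc (k + 0))
    (cong +_ (+-suc k (k + 0)))
    (conductor-suc-∷ (2 + 2 * k) ((1 + k) * (7 + 6 * k) * (8 + 6 * k))
                     (2 + 2 * k) (37 + 110 * k + 108 * (k * k) + 36 * (k * k * k))
      (conductor-TH6k+7/2k+3 k) (solve (k ∷ [])) (∈⟨⟩-≡ ((2 + 2 * k) ▸ 0 ▸ 0 ▸ ε) (solve (k ∷ []))))
    (≡THs (6 * suc k) (solve (k ∷ [])) (solve (k ∷ [])) (solve (k ∷ [])) (solve (k ∷ [])))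
    (solve (k ∷ []))

frobenius-6k+1 : ∀ n k → n ≡ 6 * k + 1 →
                 IsFrobenius (TH n) (TH (n + 1)) (TH (n + 2)) (TH (n + 3))
                   (+ (6 * k) *ℤ + TH (n + 1) +ℤ + (3 * k) *ℤ + TH (n + 2)
                     +ℤ + (2 * k) *ℤ + TH (n + 3) -ℤ + TH n)
frobenius-6k+1 _ zero    refl = isFrobenius-1
frobenius-6k+1 _ (suc k) refl =
  isFrobenius-THs-lower (6 * suc k + 1) (+ (6 * suc k)) (3 * suc k) (2 * suc k) refl
    (conductor-suc-∷ʳ (2 + 2 * k) ((2 + k) * (10 + 6 * k) * (11 + 6 * k)) 1 (73 + 72 * k + 18 * (k * k))
      (conductor-TH6k+7/2k+3 k) (solve (k ∷ [])) (∈⟨⟩-≡ (0 ▸ 0 ▸ (4 + 2 * k) ▸ ε) (solve (k ∷ []))))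
    (≡THs (6 * suc k + 1) (solve (k ∷ [])) (solve (k ∷ [])) (solve (k ∷ [])) (solve (k ∷ [])))
    (solve (k ∷ []))

frobenius-6k+2 : ∀ n k → n ≡ 6 * k + 2 →
                 IsFrobenius (TH n) (TH (n + 1)) (TH (n + 2)) (TH (n + 3))
                   (+ (6 * k + 1) *ℤ + TH (n + 1) +ℤ + (2 * k) *ℤ + TH (n + 2)
                     +ℤ + (3 * k + 1) *ℤ + TH (n + 3) -ℤ + TH n)
frobenius-6k+2 _ k refl =
  isFrobenius-THs-lower (6 * k + 2) (+ (6 * k + 1)) (2 * k) (3 * k + 1) refl
    (conductor-suc-∷ (4 + 6 * k) ((1 + 3 * k) * (1 + 2 * k) * (4 + 6 * k))
                     (4 + 6 * k) (3 + 22 * k + 48 * (k * k) + 36 * (k * k * k))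
      (conductor-TH6k+3/6k+5 k) (solve (k ∷ [])) (∈⟨⟩-≡ ((2 + 6 * k) ▸ 0 ▸ 0 ▸ ε) (solve (k ∷ []))))
    (≡THs (6 * k + 2) (solve (k ∷ [])) (solve (k ∷ [])) (solve (k ∷ [])) (solve (k ∷ [])))
    (solve (k ∷ []))

frobenius-6k+3 : ∀ n k → n ≡ 6 * k + 3 →
                 IsFrobenius (TH n) (TH (n + 1)) (TH (n + 2)) (TH (n + 3))
                   (+ (2 * k) *ℤ + TH (n + 1) +ℤ + (3 * k + 1) *ℤ + TH (n + 2)
                     +ℤ + (6 * k + 4) *ℤ + TH (n + 3) -ℤ + TH n)
frobenius-6k+3 _ k refl =
  isFrobenius-THs-lower (6 * k + 3) (+ (2 * k)) (3 * k + 1) (6 * k + 4) refl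
    (conductor-suc-∷ʳ (4 + 6 * k) ((1 + k) * (7 + 6 * k) * (8 + 6 * k)) 1 (11 + 16 * k + 6 * (k * k))
      (conductor-TH6k+3/6k+5 k) (solve (k ∷ [])) (∈⟨⟩-≡ (0 ▸ 0 ▸ (8 + 6 * k) ▸ ε) (solve (k ∷ []))))
    (≡THs (6 * k + 3) (solve (k ∷ [])) (solve (k ∷ [])) (solve (k ∷ [])) (solve (k ∷ [])))
    (solve (k ∷ []))

frobenius-6k+4 : ∀ n k → n ≡ 6 * k + 4 →
                 IsFrobenius (TH n) (TH (n + 1)) (TH (n + 2)) (TH (n + 3))
                   (+ (2 * k + 2) *ℤ + TH (n + 2) +ℤ + (3 * k + 3) *ℤ + TH (n + 1)
                     +ℤ + (6 * k + 6) *ℤ + TH n -ℤ + TH (n + 3))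
frobenius-6k+4 _ k refl =
  isFrobenius-THs-upper (6 * k + 4) (2 * k + 2) (3 * k + 3) (6 * k + 6)
    (conductor-suc-∷ (6 + 6 * k) ((4 + 6 * k) * (5 + 6 * k) * (1 + k))
                     (6 + 6 * k) (17 + 66 * k + 84 * (k * k) + 36 * (k * k * k))
      (conductor-TH6k+5/6k+7 k) (solve (k ∷ [])) (∈⟨⟩-≡ ((3 * k) ▸ (1 + 2 * k) ▸ (1 + k) ▸ ε) (solve (k ∷ []))))
    (≡THs (6 * k + 4) (solve (k ∷ [])) (solve (k ∷ [])) (solve (k ∷ [])) (solve (k ∷ [])))
    (solve (k ∷ []))

frobenius-6k+5 : ∀ n k → n ≡ 6 * k + 5 →
                 IsFrobenius (TH n) (TH (n + 1)) (TH (n + 2)) (TH (n + 3))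
                   (+ (6 * k + 9) *ℤ + TH (n + 2) +ℤ + (2 * k + 2) *ℤ + TH (n + 1)
                     +ℤ + (3 * k + 3) *ℤ + TH n -ℤ + TH (n + 3))
frobenius-6k+5 _ k refl =
  isFrobenius-THs-upper (6 * k + 5) (6 * k + 9) (2 * k + 2) (3 * k + 3)
    (conductor-suc-∷ (3 + 3 * k) ((5 + 6 * k) * (1 + k) * (7 + 6 * k))
                     (3 + 3 * k) (26 + 87 * k + 96 * (k * k) + 36 * (k * k * k))
      (conductor-TH6k+6/3k+4 k) (solve (k ∷ [])) (∈⟨⟩-≡ ((1 + 2 * k) ▸ (1 + k) ▸ 0 ▸ ε) (solve (k ∷ []))))
    (≡THs (6 * k + 5) (solve (k ∷ [])) (solve (k ∷ [])) (solve (k ∷ [])) (solve (k ∷ [])))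
    (solve (k ∷ []))

proposition12 : ∀ (n k : ℕ) → n ≥ 1 →
    (n ≡ 6 * k →
      IsFrobenius (TH n) (TH (n + 1)) (TH (n + 2)) (TH (n + 3))
        ((+ (2 * k) -ℤ + 1) *ℤ + TH (n + 1) +ℤ + (6 * k) *ℤ + TH (n + 2)
          +ℤ + (3 * k) *ℤ + TH (n + 3) -ℤ + TH n))
  × (n ≡ 6 * k + 1 →
      IsFrobenius (TH n) (TH (n + 1)) (TH (n + 2)) (TH (n + 3))
        (+ (6 * k) *ℤ + TH (n + 1) +ℤ + (3 * k) *ℤ + TH (n + 2)
          +ℤ + (2 * k) *ℤ + TH (n + 3) -ℤ + TH n))
  × (n ≡ 6 * k + 2 →
      IsFrobenius (TH n) (TH (n + 1)) (TH (n + 2)) (TH (n + 3))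
        (+ (6 * k + 1) *ℤ + TH (n + 1) +ℤ + (2 * k) *ℤ + TH (n + 2)
          +ℤ + (3 * k + 1) *ℤ + TH (n + 3) -ℤ + TH n))
  × (n ≡ 6 * k + 3 →
      IsFrobenius (TH n) (TH (n + 1)) (TH (n + 2)) (TH (n + 3))
        (+ (2 * k) *ℤ + TH (n + 1) +ℤ + (3 * k + 1) *ℤ + TH (n + 2)
          +ℤ + (6 * k + 4) *ℤ + TH (n + 3) -ℤ + TH n))
  × (n ≡ 6 * k + 4 →
      IsFrobenius (TH n) (TH (n + 1)) (TH (n + 2)) (TH (n + 3))
        (+ (2 * k + 2) *ℤ + TH (n + 2) +ℤ + (3 * k + 3) *ℤ + TH (n + 1)
          +ℤ + (6 * k + 6) *ℤ + TH n -ℤ + TH (n + 3)))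
  × (n ≡ 6 * k + 5 →
      IsFrobenius (TH n) (TH (n + 1)) (TH (n + 2)) (TH (n + 3))
        (+ (6 * k + 9) *ℤ + TH (n + 2) +ℤ + (2 * k + 2) *ℤ + TH (n + 1)
          +ℤ + (3 * k + 3) *ℤ + TH n -ℤ + TH (n + 3)))
proposition12 n k n≥1 =
    frobenius-6k n k n≥1 , frobenius-6k+1 n k , frobenius-6k+2 n k
  , frobenius-6k+3 n k , frobenius-6k+4 n k , frobenius-6k+5 n k
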